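{- Let $\mathcal{G}=(L,\vee,\wedge,\odot,\rightarrow,0,1)$ be a right-residuated l-groupoid. Then $\mathcal{G}$ satisfies the double negation law and condition (C) if and only if $\mathcal{G}$ is involutive and $x\odot y=\rceil(y\rightarrow\rceil x)$ holds for all $x,y\in L$.
   Context: A right-residuated l-groupoid is an algebra $(L,\vee,\wedge,\odot,\rightarrow,0,1)$ of type $(2,2,2,2,0,0)$ such that $(L,\vee,\wedge)$ is a lattice with least element $0$ and greatest element $1$, $1\odot x=x$ for all $x$, and $x\odot y\le z$ iff $x\le y\rightarrow z$ for all $x,y,z$. Put $\rceil x:=x\rightarrow 0$. The double negation law is $\rceil\rceil x=x$ for all $x$. $\mathcal{G}$ is involutive if $x\le y$ implies $\rceil y\le\rceil x$ and $\rceil\rceil x=x$ for all $x,y$. Condition (C): for all $x,y,z\in L$, $z\le x\odot y$ if and only if $y\rightarrow\rceil x\le\rceil z$. -}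

module Defs where

open import Level using (Level; suc; _⊔_)
open import Data.Product using (_×_)
open import Relation.Binary.Core using (Rel)
open import Algebra.Core using (Op₂)
open import Algebra.Lattice.Bundles using (Lattice)
open import Function.Bundles using (_⇔_)

record RRLGroupoid (c ℓ : Level) : Set (suc (c ⊔ ℓ)) where
  field
    lattice : Lattice c ℓ
  open Lattice lattice public
  infixl 7 _⊙_
  infixr 5 _⇒_
  field
    _⊙_  : Op₂ Carrier
    _⇒_  : Op₂ Carrier
    𝟘 𝟙  : Carrier
    ⊙-cong : ∀ {x x′ y y′} → x ≈ x′ → y ≈ y′ → (x ⊙ y) ≈ (x′ ⊙ y′)
    ⇒-cong : ∀ {x x′ y y′} → x ≈ x′ → y ≈ y′ → (x ⇒ y) ≈ (x′ ⇒ y′)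

  _≤_ : Rel Carrier ℓ
  x ≤ y = (x ∧ y) ≈ x

  field
    𝟘-least    : ∀ x → 𝟘 ≤ x
    𝟙-greatest : ∀ x → x ≤ 𝟙
    𝟙-identityˡ : ∀ x → (𝟙 ⊙ x) ≈ x
    residuation : ∀ x y z → ((x ⊙ y) ≤ z) ⇔ (x ≤ (y ⇒ z))

  ¬′ : Carrier → Carrier
  ¬′ x = x ⇒ 𝟘

  DoubleNegation : Set (c ⊔ ℓ)
  DoubleNegation = ∀ x → ¬′ (¬′ x) ≈ x

  Involutive : Set (c ⊔ ℓ)
  Involutive = (∀ x y → x ≤ y → ¬′ y ≤ ¬′ x) × (∀ x → ¬′ (¬′ x) ≈ x)

  ConditionC : Set (c ⊔ ℓ)
  ConditionC = ∀ x y z → (z ≤ (x ⊙ y)) ⇔ ((y ⇒ ¬′ x) ≤ ¬′ z)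

module Submission where

open import Defs
open import Level using (_⊔_)
open import Data.Product using (_×_; _,_; proj₂)
open import Function.Bundles using (_⇔_; mk⇔; Equivalence)
open import Relation.Binary.Bundles using (Poset)
import Algebra.Lattice.Properties.Lattice as LatticeProperties

-- Forward: instantiating (C) at x = 𝟙 and using ¬𝟙 ≈ 𝟘 shows that ¬ is antitone,
-- and an antitone involution satisfies z ≤ ¬w ⇔ w ≤ ¬z; (C) says exactly that
-- x ⊙ y and ¬(y ⇒ ¬x) have the same lower bounds. Backward: rewriting x ⊙ y
-- as ¬(y ⇒ ¬x) turns (C) into that same Galois property of ¬.

module Properties {c ℓ} (G : RRLGroupoid c ℓ) where
  open RRLGroupoid G
  open Equivalence using (to; from)
  private module P = Poset (LatticeProperties.poset lattice)

  -- The lattice-properties poset orders by x ≈ x ∧ y, the converse of _≤_.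
  ≤-refl : ∀ {x} → x ≤ x
  ≤-refl = sym P.refl

  ≤-reflexive : ∀ {x y} → x ≈ y → x ≤ y
  ≤-reflexive e = sym (P.reflexive e)

  ≤-trans : ∀ {x y z} → x ≤ y → y ≤ z → x ≤ z
  ≤-trans p q = sym (P.trans (sym p) (sym q))

  ≤-antisym : ∀ {x y} → x ≤ y → y ≤ x → x ≈ y
  ≤-antisym p q = P.antisym (sym p) (sym q)

  ¬-Antitone : Set (c ⊔ ℓ)
  ¬-Antitone = ∀ x y → x ≤ y → ¬′ y ≤ ¬′ x

  ¬𝟘≈𝟙 : ¬′ 𝟘 ≈ 𝟙
  ¬𝟘≈𝟙 = ≤-antisym (𝟙-greatest _) (to (residuation 𝟙 𝟘 𝟘) (≤-reflexive (𝟙-identityˡ 𝟘)))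

  ¬𝟙≈𝟘 : DoubleNegation → ¬′ 𝟙 ≈ 𝟘
  ¬𝟙≈𝟘 dn = trans (⇒-cong (sym ¬𝟘≈𝟙) refl) (dn 𝟘)

  ¬-galois : ¬-Antitone → DoubleNegation → ∀ {z w} → z ≤ ¬′ w → w ≤ ¬′ z
  ¬-galois anti dn {z} {w} z≤¬w = ≤-trans (≤-reflexive (sym (dn w))) (anti z (¬′ w) z≤¬w)

  conditionC⇒¬-antitone : DoubleNegation → ConditionC → ¬-Antitone
  conditionC⇒¬-antitone dn cc x y x≤y = ≤-trans
    (≤-reflexive (⇒-cong refl (sym (¬𝟙≈𝟘 dn))))
    (to (cc 𝟙 y x) (≤-trans x≤y (≤-reflexive (sym (𝟙-identityˡ y)))))

  conditionC⇒⊙≈¬⇒¬ : DoubleNegation → ConditionC → ∀ x y → (x ⊙ y) ≈ ¬′ (y ⇒ ¬′ x)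
  conditionC⇒⊙≈¬⇒¬ dn cc x y = ≤-antisym
    (¬-galois (conditionC⇒¬-antitone dn cc) dn (to (cc x y (x ⊙ y)) ≤-refl))
    (from (cc x y _) (≤-reflexive (sym (dn _))))

  ⊙≈¬⇒¬⇒conditionC : Involutive → (∀ x y → (x ⊙ y) ≈ ¬′ (y ⇒ ¬′ x)) → ConditionC
  ⊙≈¬⇒¬⇒conditionC (anti , dn) ⊙≈ x y z = mk⇔
    (λ z≤x⊙y → ¬-galois anti dn (≤-trans z≤x⊙y (≤-reflexive (⊙≈ x y))))
    (λ w≤¬z → ≤-trans (¬-galois anti dn w≤¬z) (≤-reflexive (sym (⊙≈ x y))))

proposition1 : ∀ {c ℓ} (G : RRLGroupoid c ℓ) → let open RRLGroupoid G in
    (DoubleNegation × ConditionC) ⇔ (Involutive × (∀ x y → (x ⊙ y) ≈ ¬′ (y ⇒ ¬′ x)))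
proposition1 G = mk⇔
  (λ (dn , cc) → (conditionC⇒¬-antitone dn cc , dn) , conditionC⇒⊙≈¬⇒¬ dn cc)
  (λ (inv , ⊙≈) → proj₂ inv , ⊙≈¬⇒¬⇒conditionC inv ⊙≈)
  where open Properties G
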